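{- Let $m,n\ge0$ be integers and let $\mu,\nu$ be partitions of lengths at most $m$ and $n$. Then $\mu\star_{m,n}\nu=\infty$ if and only if there exist a path $\pi\in\mathfrak P(n,m)$ and a quasi-partition $\alpha$ associated to $\pi$ such that $\alpha$ is not a partition, $\mu=\mu(\pi)+\alpha_{V(\pi)}$ and $\nu=\nu(\pi)'+\alpha_{H(\pi)}$.
   Context: $\mathfrak P(n,m)$ is the set of lattice paths from the top-right to the bottom-left corner of an $n\times m$ rectangle (width $n$, height $m$) using unit west and south steps. $V(\pi)=(V_1<\dots<V_m)$, $H(\pi)=(H_1<\dots<H_n)$ are the times (in $\{1,\dots,m+n\}$) of the south resp. west steps. $\mu(\pi)_i=n+i-V_i$ ($1\le i\le m$) and $\nu(\pi)$ is the partition with conjugate $\nu(\pi)'_j=m+j-H_j$ ($1\le j\le n$). For a sequence $\alpha$ and increasing indices $K$, $\alpha_K=(\alpha_{K_1},\alpha_{K_2},\dots)$; sums are entrywise. A quasi-partition associated to $\pi$ is a sequence $\alpha$ of $m+n$ (possibly negative) integers with $\alpha_{m+n}\ge0$, such that there is no index $i$ with $\alpha_{i-1}<\alpha_i<\alpha_{i+1}$; if $i,i+1\in V(\pi)$ or $i,i+1\in H(\pi)$ then $\alpha_{i+1}\le\alpha_i$; and if one of $i,i+1$ lies in $V(\pi)$ and the other in $H(\pi)$ then $\alpha_{i+1}\le\alpha_i+1$. With $\rho_j=(j-1,\dots,1,0)$, $\mu\star_{m,n}\nu$ is the partition $\kappa$ with $\kappa+\rho_{m+n}$ a rearrangement of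 the concatenation $(\mu+\rho_m)\cup(\nu+\rho_n)$ if such a partition exists, and otherwise $\mu\star_{m,n}\nu=\infty$ (equivalently, $\infty$ exactly when $(\mu+\rho_m)\cup(\nu+\rho_n)$ has a repeated entry). -}

module Defs where

open import Data.Nat as ℕ using (ℕ; zero; suc)
open import Data.Integer as ℤ using (ℤ; +_)
open import Data.Fin using (Fin; toℕ)
import Data.Fin as Fin
open import Data.Vec as Vec using (Vec; []; _∷_; toList)
open import Data.List as List using (List; []; _∷_; map; zipWith; zip; _++_)
open import Data.List.Relation.Unary.All using (All)
open import Data.List.Relation.Binary.Permutation.Propositional using (_↭_)
open import Data.Product using (Σ; _×_)
open import Data.Unit using (⊤)
open import Relation.Nullary using (¬_)
open import Relation.Binary.PropositionalEquality using (_≡_)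

-- A partition of length at most k, stored as a weakly decreasing
-- vector of k natural numbers (padded with trailing zeros).
IsPartition : ∀ {k} → Vec ℕ k → Set
IsPartition [] = ⊤
IsPartition (x ∷ []) = ⊤
IsPartition (x ∷ y ∷ r) = (y ℕ.≤ x) × IsPartition (y ∷ r)

Decreasingℤ : List ℤ → Set
Decreasingℤ [] = ⊤
Decreasingℤ (x ∷ []) = ⊤
Decreasingℤ (x ∷ y ∷ r) = (y ℤ.≤ x) × Decreasingℤ (y ∷ r)

IsPartitionℤ : List ℤ → Set
IsPartitionℤ xs = All (λ x → + 0 ℤ.≤ x) xs × Decreasingℤ xs

ρ : (k : ℕ) → Vec ℕ k
ρ zero = []
ρ (suc k) = k ∷ ρ k

_+ρ : ∀ {k} → Vec ℕ k → Vec ℕ k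
_+ρ {k} v = Vec.zipWith ℕ._+_ v (ρ k)

-- μ ⋆_{m,n} ν = ∞ : there is no partition κ (of length ≤ m+n) such that
-- κ + ρ_{m+n} is a rearrangement of (μ + ρ_m) ∪ (ν + ρ_n).
StarInfinite : ∀ {m n} → Vec ℕ m → Vec ℕ n → Set
StarInfinite {m} {n} μ ν =
  ¬ (Σ (Vec ℕ (m ℕ.+ n)) λ κ →
       IsPartition κ × (toList (κ +ρ) ↭ (toList (μ +ρ) ++ toList (ν +ρ))))

data Step : Set where
  S W : Step

countS : ∀ {k} → Vec Step k → ℕ
countS [] = 0
countS (S ∷ s) = suc (countS s)
countS (W ∷ s) = countS s

-- 𝔓(n,m): paths from top-right to bottom-left corner of the n×m rectangle
-- (width n, height m): m+n steps, exactly m of them south.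
Path : ℕ → ℕ → Set
Path n m = Σ (Vec Step (m ℕ.+ n)) λ s → countS s ≡ m

-- increasing list of positions (0-based, as Fin) of south / west steps;
-- the time in {1,…,m+n} of position p is toℕ p + 1.
posS posW : ∀ {k} → Vec Step k → List (Fin k)
posS [] = []
posS (S ∷ s) = Fin.zero ∷ map Fin.suc (posS s)
posS (W ∷ s) = map Fin.suc (posS s)
posW [] = []
posW (S ∷ s) = map Fin.suc (posW s)
posW (W ∷ s) = Fin.zero ∷ map Fin.suc (posW s)

V H : ∀ {n m} → Path n m → List (Fin (m ℕ.+ n))
V π = posS (Data.Product.proj₁ π)
H π = posW (Data.Product.proj₁ π)

shapeSeq : ∀ {k} → ℕ → ℕ → List (Fin k) → List ℤ
shapeSeq c i [] = []
shapeSeq c i (p ∷ ps) = (+ (c ℕ.+ i) ℤ.- + suc (toℕ p)) ∷ shapeSeq c (suc i) ps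

μπ : ∀ {n m} → Path n m → List ℤ
μπ {n} π = shapeSeq n 1 (V π)

ν'π : ∀ {n m} → Path n m → List ℤ
ν'π {n} {m} π = shapeSeq m 1 (H π)

sub : ∀ {k} → Vec ℤ k → List (Fin k) → List ℤ
sub α K = map (Vec.lookup α) K

LastNonneg : List ℤ → Set
LastNonneg [] = ⊤
LastNonneg (x ∷ []) = + 0 ℤ.≤ x
LastNonneg (x ∷ y ∷ r) = LastNonneg (y ∷ r)

NoStrictAscent3 : List ℤ → Set
NoStrictAscent3 (x ∷ y ∷ z ∷ r) = ¬ (x ℤ.< y × y ℤ.< z) × NoStrictAscent3 (y ∷ z ∷ r)
NoStrictAscent3 _ = ⊤

StepBound : Step → Step → ℤ → ℤ → Set
StepBound S S a b = b ℤ.≤ a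
StepBound W W a b = b ℤ.≤ a
StepBound S W a b = b ℤ.≤ a ℤ.+ + 1
StepBound W S a b = b ℤ.≤ a ℤ.+ + 1

AdjBound : List (Step × ℤ) → Set
AdjBound (Data.Product._,_ s a ∷ Data.Product._,_ t b ∷ r) =
  StepBound s t a b × AdjBound (Data.Product._,_ t b ∷ r)
AdjBound _ = ⊤

IsQuasiPartition : ∀ {n m} → Path n m → Vec ℤ (m ℕ.+ n) → Set
IsQuasiPartition π α =
  LastNonneg (toList α) ×
  NoStrictAscent3 (toList α) ×
  AdjBound (zip (toList (Data.Product.proj₁ π)) (toList α))

-- Write A = μ + ρ_m and B = ν + ρ_n; both are strictly decreasing.  The
-- whole proof passes through γ = α + ρ_{m+n}, and rests on three facts.
--
-- * Translation: for any list of positions, μ = μ(π) + α_V holds iff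
--   μ + ρ_m = γ_V, because μ(π) + ρ_m is exactly ρ_{m+n} read at V(π).
--   So the two equations of the theorem say: the south part of γ is A and
--   the west part of γ is B.
-- * Forward: merging A and B gives a path π and a weakly decreasing γ with
--   these parts.  α = γ − ρ is then a quasi-partition (each condition on α
--   is a comparison of neighbouring entries of γ).  If α were a partition,
--   γ would be strictly decreasing and κ = γ − ρ would show μ ⋆ ν ≠ ∞.
-- * Backward: if κ exists, A ∪ B has no repeated entry, so the two parts of
--   γ are disjoint; with the step bounds of a quasi-partition this forces α
--   to be weakly decreasing, hence a partition.
module Submission where

open import Defs
open import Data.Nat using (ℕ; _+_)
open import Data.Integer using (ℤ; +_)
open import Data.Vec using (Vec; toList)
open import Data.List using (map; zipWith)
open import Data.Product using (Σ; _×_)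
open import Relation.Nullary using (¬_)
open import Relation.Binary.PropositionalEquality using (_≡_)
open import Function.Bundles using (_⇔_)

open import Data.Nat as ℕ using (suc; zero; _∸_; _<_; _≤_; _>_; _≥_; z≤n)
import Data.Nat.Properties as ℕP
import Data.Integer as ℤ
open import Data.Integer using (+≤+)
import Data.Integer.Properties as ℤP
open import Data.Integer.Solver using (module +-*-Solver)
open import Data.Fin using (Fin; toℕ)
import Data.Fin as Fin
open import Data.Vec as Vec using ([]; _∷_)
import Data.Vec.Properties as VP
open import Data.List as List using (List; []; _∷_; _++_; length; zip)
import Data.List.Properties as LP
open import Data.List.Relation.Unary.All as All using ([]; _∷_)
open import Data.List.Relation.Unary.AllPairs as AllPairs using (_∷_)
open import Data.List.Relation.Unary.Any using (here; there)
open import Data.List.Relation.Unary.Linked as Linked using (Linked; []; [-]; _∷_; _∷′_)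
open import Data.List.Relation.Unary.Linked.Properties using (Linked⇒AllPairs)
open import Data.List.Relation.Unary.Unique.Propositional using (Unique)
import Data.List.Relation.Unary.Unique.Propositional.Properties as Unique
open import Data.List.Relation.Binary.Disjoint.Propositional using (Disjoint; contractₗ; contractᵣ)
open import Data.List.Membership.Propositional.Properties using (∈-++⁺ʳ)
open import Data.List.Relation.Binary.Permutation.Propositional using (_↭_; prep; ↭-sym; ↭-trans; ↭⇒↭ₛ)
import Data.List.Relation.Binary.Permutation.Propositional.Properties as ↭P
open import Data.Maybe using (just)
open import Data.Maybe.Relation.Binary.Connected using (Connected; just; just-nothing)
open import Data.Product using (_,_; proj₁)
open import Data.Sum using (_⊎_; inj₁; inj₂)
open import Data.Unit using (tt)
open import Data.Empty using (⊥)
open import Relation.Nullary using (yes; no)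
open import Relation.Binary.PropositionalEquality
  using (refl; sym; trans; cong; cong₂; subst; subst₂; _≢_; module ≡-Reasoning)
open import Function.Bundles using (mk⇔; Equivalence)
open import Relation.Binary.PropositionalEquality.Properties using (setoid)
open import Data.List.Relation.Binary.Permutation.Setoid.Properties (setoid ℕ) using (Unique-resp-↭)

open +-*-Solver using (solve; _:+_; _:-_; _:=_; con)
open Equivalence using (to; from)

+-−-cancel : ∀ (x c : ℤ) → x ℤ.+ c ℤ.- c ≡ x
+-−-cancel = solve 2 (λ x c → x :+ c :- c := x) refl

cancelʳ-≤ : ∀ c {i j : ℤ} → i ℤ.+ c ℤ.≤ j ℤ.+ c → i ℤ.≤ j
cancelʳ-≤ c {i} {j} le = subst₂ ℤ._≤_ (+-−-cancel i c) (+-−-cancel j c) (ℤP.+-monoˡ-≤ (ℤ.- c) le)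

cancelʳ-≡ : ∀ c {i j : ℤ} → i ℤ.+ c ≡ j ℤ.+ c → i ≡ j
cancelʳ-≡ c {i} {j} eq = trans (sym (+-−-cancel i c)) (trans (cong (ℤ._- c) eq) (+-−-cancel j c))

-- Neighbouring entries of ρ differ by one, so comparing entries of γ − ρ
-- at positions i, i+1 is comparing entries of γ with a shift by one.
descent⇔ : ∀ {x y} r → y < x ⇔ (+ y ℤ.- + r) ℤ.≤ (+ x ℤ.- + suc r)
descent⇔ {x} {y} r = mk⇔
  (λ y<x → cancelʳ-≤ (+ suc r) (subst₂ ℤ._≤_ (sym shiftY) (sym shiftX) (+≤+ y<x)))
  (λ le → ℤP.drop‿+≤+ (subst₂ ℤ._≤_ shiftY shiftX (ℤP.+-monoˡ-≤ (+ suc r) le)))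
  where
  shiftY : (+ y ℤ.- + r) ℤ.+ + suc r ≡ + suc y
  shiftY = solve 2 (λ y r → (y :- r) :+ (con (+ 1) :+ r) := con (+ 1) :+ y) refl (+ y) (+ r)
  shiftX : (+ x ℤ.- + suc r) ℤ.+ + suc r ≡ + x
  shiftX = solve 2 (λ x s → (x :- s) :+ s := x) refl (+ x) (+ suc r)

weakDescent : ∀ {x y} r → y ≤ x → (+ y ℤ.- + r) ℤ.≤ (+ x ℤ.- + suc r) ℤ.+ + 1
weakDescent {x} {y} r y≤x = cancelʳ-≤ (+ r) (subst₂ ℤ._≤_ (sym shiftY) (sym shiftX) (+≤+ y≤x))
  where
  shiftY : (+ y ℤ.- + r) ℤ.+ + r ≡ + y
  shiftY = solve 2 (λ y r → (y :- r) :+ r := y) refl (+ y) (+ r)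
  shiftX : ((+ x ℤ.- + suc r) ℤ.+ + 1) ℤ.+ + r ≡ + x
  shiftX = solve 2 (λ x r → ((x :- (con (+ 1) :+ r)) :+ con (+ 1)) :+ r := x) refl (+ x) (+ r)

ascent⇒≤ : ∀ {x y} r → (+ x ℤ.- + suc r) ℤ.< (+ y ℤ.- + r) → x ≤ y
ascent⇒≤ r lt = ℕP.≮⇒≥ (λ y<x → ℤP.≤⇒≯ (to (descent⇔ r) y<x) lt)

≤-below-suc : ∀ {a b : ℤ} → b ℤ.≤ a ℤ.+ + 1 → b ≢ a ℤ.+ + 1 → b ℤ.≤ a
≤-below-suc {a} le ne = subst (_ ℤ.≤_) predSuc (ℤP.i<j⇒i≤pred[j] (ℤP.≤∧≢⇒< le ne))
  where
  predSuc : ℤ.pred (a ℤ.+ + 1) ≡ a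
  predSuc = solve 1 (λ a → con ℤ.-1ℤ :+ (a :+ con (+ 1)) := a) refl a

rebalance : ∀ (a ℓ P D R : ℤ) → ℓ ℤ.+ P ≡ D ℤ.+ R → a ℤ.+ ℓ ≡ ((D ℤ.- P) ℤ.+ a) ℤ.+ R
rebalance a ℓ P D R eq = begin
  a ℤ.+ ℓ
    ≡⟨ solve 3 (λ a ℓ P → a :+ ℓ := (a :+ (ℓ :+ P)) :- P) refl a ℓ P ⟩
  (a ℤ.+ (ℓ ℤ.+ P)) ℤ.- P
    ≡⟨ cong (λ z → (a ℤ.+ z) ℤ.- P) eq ⟩
  (a ℤ.+ (D ℤ.+ R)) ℤ.- P
    ≡⟨ solve 4 (λ a P D R → (a :+ (D :+ R)) :- P := ((D :- P) :+ a) :+ R) refl a P D R ⟩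
  ((D ℤ.- P) ℤ.+ a) ℤ.+ R
    ∎
  where open ≡-Reasoning

lookup-ρ : ∀ {k} (p : Fin k) → Vec.lookup (ρ k) p + suc (toℕ p) ≡ k
lookup-ρ {suc k} Fin.zero = ℕP.+-comm k 1
lookup-ρ {suc k} (Fin.suc p) = trans (ℕP.+-suc _ (suc (toℕ p))) (cong suc (lookup-ρ p))

_+ρᶻ : ∀ {k} → Vec ℤ k → Vec ℤ k
_+ρᶻ {k} α = Vec.zipWith ℤ._+_ α (Vec.map +_ (ρ k))

lookup-+ρᶻ : ∀ {k} (α : Vec ℤ k) (p : Fin k) →
  Vec.lookup (α +ρᶻ) p ≡ Vec.lookup α p ℤ.+ + Vec.lookup (ρ k) p
lookup-+ρᶻ {k} α p =
  trans (VP.lookup-zipWith ℤ._+_ p α _) (cong (λ z → Vec.lookup α p ℤ.+ z) (VP.lookup-map p +_ (ρ k)))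

_-ρ : ∀ {k} → Vec ℕ k → Vec ℤ k
_-ρ {k} γ = Vec.zipWith (λ g r → + g ℤ.- + r) γ (ρ k)

-ρ+ρ : ∀ {k} (γ : Vec ℕ k) → (γ -ρ) +ρᶻ ≡ Vec.map +_ γ
-ρ+ρ [] = refl
-ρ+ρ {suc k} (g ∷ γ) = cong₂ _∷_ (solve 2 (λ g r → (g :- r) :+ r := g) refl (+ g) (+ k)) (-ρ+ρ γ)

liftedPart : ∀ {k} (γ : Vec ℕ k) (ps : List (Fin k)) {X : List ℕ} →
  map (Vec.lookup γ) ps ≡ X → map +_ X ≡ sub ((γ -ρ) +ρᶻ) ps
liftedPart γ ps {X} part = begin
  map +_ X                                ≡⟨ cong (map (+_)) (sym part) ⟩
  map +_ (map (Vec.lookup γ) ps)          ≡⟨ LP.map-∘ ps ⟨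
  map (λ p → + Vec.lookup γ p) ps         ≡⟨ LP.map-cong (λ p → VP.lookup-map p +_ γ) ps ⟨
  map (Vec.lookup (Vec.map +_ γ)) ps      ≡⟨ cong (λ v → map (Vec.lookup v) ps) (-ρ+ρ γ) ⟨
  sub ((γ -ρ) +ρᶻ) ps                     ∎
  where open ≡-Reasoning

-- κ = γ − ρ, for a sequence of naturals dominating ρ
_∸ρ : ∀ {k} → Vec ℕ k → Vec ℕ k
_∸ρ {k} γ = Vec.zipWith _∸_ γ (ρ k)

partition⇒strict : ∀ {k} (μ : Vec ℕ k) → IsPartition μ → Linked _>_ (toList (μ +ρ))
partition⇒strict [] _ = []
partition⇒strict (x ∷ []) _ = [-]
partition⇒strict {suc (suc k)} (x ∷ y ∷ μ) (y≤x , p) =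
  ℕP.+-mono-≤-< y≤x (ℕP.n<1+n k) ∷ partition⇒strict (y ∷ μ) p

length≤head : ∀ {k} x (γ : Vec ℕ k) → Linked _>_ (toList (x ∷ γ)) → k ≤ x
length≤head x [] _ = z≤n
length≤head x (y ∷ γ) (y<x ∷ sd) = ℕP.≤-trans (ℕ.s≤s (length≤head y γ sd)) y<x

∸ρ+ρ : ∀ {k} (γ : Vec ℕ k) → Linked _>_ (toList γ) → (γ ∸ρ) +ρ ≡ γ
∸ρ+ρ [] _ = refl
∸ρ+ρ (x ∷ γ) sd = cong₂ _∷_ (ℕP.m∸n+n≡m (length≤head x γ sd)) (∸ρ+ρ γ (Linked.tail sd))

∸ρ-partition : ∀ {k} (γ : Vec ℕ k) → Linked _>_ (toList γ) → IsPartition (γ ∸ρ)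
∸ρ-partition [] _ = tt
∸ρ-partition (x ∷ []) _ = tt
∸ρ-partition {suc (suc k)} (x ∷ y ∷ γ) (y<x ∷ sd) =
  ℕP.∸-monoˡ-≤ (suc k) y<x , ∸ρ-partition (y ∷ γ) sd

strict⇒unique : ∀ {xs : List ℕ} → Linked _>_ xs → Unique xs
strict⇒unique sd = AllPairs.map ℕP.>⇒≢ (Linked⇒AllPairs (λ x>y y>z → ℕP.<-trans y>z x>y) sd)

unique-++⇒disjoint : ∀ {A : Set} (xs ys : List A) → Unique (xs ++ ys) → Disjoint xs ys
unique-++⇒disjoint [] ys _ (() , _)
unique-++⇒disjoint (x ∷ xs) ys (x∉ ∷ _) (here refl , v∈ys) = All.lookup x∉ (∈-++⁺ʳ xs v∈ys) refl
unique-++⇒disjoint (x ∷ xs) ys (_ ∷ u) (there v∈xs , v∈ys) = unique-++⇒disjoint xs ys u (v∈xs , v∈ys)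

rearrangement⇒disjoint : ∀ {k} (κ : Vec ℕ k) (A B : List ℕ) → IsPartition κ →
  toList (κ +ρ) ↭ A ++ B → Disjoint (map +_ A) (map +_ B)
rearrangement⇒disjoint κ A B pκ κ↭AB =
  unique-++⇒disjoint (map +_ A) (map +_ B)
    (subst Unique (LP.map-++ +_ A B) (Unique.map⁺ ℤP.+-injective unique-AB))
  where
  unique-AB : Unique (A ++ B)
  unique-AB = Unique-resp-↭ (↭⇒↭ₛ κ↭AB) (strict⇒unique (partition⇒strict κ pκ))

southPart westPart : ∀ {A : Set} {k} → Vec Step k → Vec A k → List A
southPart [] [] = []
southPart (S ∷ s) (x ∷ v) = x ∷ southPart s v
southPart (W ∷ s) (x ∷ v) = southPart s v
westPart [] [] = []
westPart (S ∷ s) (x ∷ v) = westPart s v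
westPart (W ∷ s) (x ∷ v) = x ∷ westPart s v

posS-southPart : ∀ {A : Set} {k} (s : Vec Step k) (v : Vec A k) → map (Vec.lookup v) (posS s) ≡ southPart s v
posS-southPart [] [] = refl
posS-southPart (S ∷ s) (x ∷ v) = cong (x ∷_) (trans (sym (LP.map-∘ (posS s))) (posS-southPart s v))
posS-southPart (W ∷ s) (x ∷ v) = trans (sym (LP.map-∘ (posS s))) (posS-southPart s v)

posW-westPart : ∀ {A : Set} {k} (s : Vec Step k) (v : Vec A k) → map (Vec.lookup v) (posW s) ≡ westPart s v
posW-westPart [] [] = refl
posW-westPart (S ∷ s) (x ∷ v) = trans (sym (LP.map-∘ (posW s))) (posW-westPart s v)
posW-westPart (W ∷ s) (x ∷ v) = cong (x ∷_) (trans (sym (LP.map-∘ (posW s))) (posW-westPart s v))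

length-southPart : ∀ {A : Set} {k} (s : Vec Step k) (v : Vec A k) → length (southPart s v) ≡ countS s
length-southPart [] [] = refl
length-southPart (S ∷ s) (x ∷ v) = cong suc (length-southPart s v)
length-southPart (W ∷ s) (x ∷ v) = length-southPart s v

split-↭ : ∀ {A : Set} {k} (s : Vec Step k) (v : Vec A k) → toList v ↭ southPart s v ++ westPart s v
split-↭ [] [] = _↭_.refl
split-↭ (S ∷ s) (x ∷ v) = prep x (split-↭ s v)
split-↭ (W ∷ s) (x ∷ v) =
  ↭-trans (prep x (split-↭ s v)) (↭-sym (↭P.shift x (southPart s v) (westPart s v)))

StrictParts : ∀ {k} → Vec Step k → Vec ℕ k → Set
StrictParts s γ = Linked _>_ (southPart s γ) × Linked _>_ (westPart s γ)

strictParts-tail : ∀ {k} t (s : Vec Step k) {x} {γ : Vec ℕ k} →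
  StrictParts (t ∷ s) (x ∷ γ) → StrictParts s γ
strictParts-tail S _ (south , west) = Linked.tail south , west
strictParts-tail W _ (south , west) = south , Linked.tail west

disjoint-tail : ∀ {A : Set} {k} t (s : Vec Step k) {x} {v : Vec A k} →
  Disjoint (southPart (t ∷ s) (x ∷ v)) (westPart (t ∷ s) (x ∷ v)) → Disjoint (southPart s v) (westPart s v)
disjoint-tail S _ dj = contractₗ dj
disjoint-tail W _ dj = contractᵣ dj

-- Translation: μ = μ(π) + α_V  iff  μ + ρ = (α + ρ)_V

∷-cong⇔ : ∀ {A B : Set} {x y : A} {xs ys : List A} {x′ y′ : B} {xs′ ys′ : List B} →
  (x ≡ y ⇔ x′ ≡ y′) → (xs ≡ ys ⇔ xs′ ≡ ys′) →
  (x ∷ xs ≡ y ∷ ys) ⇔ (x′ ∷ xs′ ≡ y′ ∷ ys′)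
∷-cong⇔ h t = mk⇔
  (λ e → cong₂ _∷_ (to h (LP.∷-injectiveˡ e)) (to t (LP.∷-injectiveʳ e)))
  (λ e → cong₂ _∷_ (from h (LP.∷-injectiveˡ e)) (from t (LP.∷-injectiveʳ e)))

-- Positions ps in {0,…,k−1} are read from index j+1 on, against a vector v
-- of r entries, with c + j + r = k.  At the first position p the shape entry
-- c + (j+1) − (p+1) plus the first entry r − 1 of ρ_r is ρ_k at p, so
-- v = shape + α_ps holds iff v + ρ_r = (α + ρ_k)_ps.
translate : ∀ {k r} c j (ps : List (Fin k)) (v : Vec ℕ r) (α : Vec ℤ k) → c + j + r ≡ k →
  (map +_ (toList v) ≡ zipWith ℤ._+_ (shapeSeq c (suc j) ps) (sub α ps))
    ⇔ (map +_ (toList (v +ρ)) ≡ sub (α +ρᶻ) ps)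
translate c j [] [] α _ = mk⇔ (λ _ → refl) (λ _ → refl)
translate c j [] (x ∷ v) α _ = mk⇔ (λ ()) (λ ())
translate c j (p ∷ ps) [] α _ = mk⇔ (λ ()) (λ ())
translate {k} {suc r} c j (p ∷ ps) (x ∷ v) α eq =
  ∷-cong⇔ headEntry (translate c (suc j) ps v α tailEq)
  where
  tailEq : c + suc j + r ≡ k
  tailEq = trans (cong (_+ r) (ℕP.+-suc c j)) (trans (sym (ℕP.+-suc (c + j) r)) eq)
  shape : ℤ
  shape = + (c + suc j) ℤ.- + suc (toℕ p)
  entry : Vec.lookup (α +ρᶻ) p ≡ (shape ℤ.+ Vec.lookup α p) ℤ.+ + r
  entry = trans (lookup-+ρᶻ α p)
    (rebalance (Vec.lookup α p) (+ Vec.lookup (ρ k) p) (+ suc (toℕ p)) (+ (c + suc j)) (+ r)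
      (cong +_ (trans (lookup-ρ p) (sym tailEq))))
  headEntry : (+ x ≡ shape ℤ.+ Vec.lookup α p) ⇔ (+ (x + r) ≡ Vec.lookup (α +ρᶻ) p)
  headEntry = mk⇔ (λ e → trans (cong (ℤ._+ + r) e) (sym entry)) (λ e → cancelʳ-≡ (+ r) (trans e entry))

μ-translate : ∀ {m n} (π : Path n m) (μ : Vec ℕ m) (α : Vec ℤ (m + n)) →
  (map +_ (toList μ) ≡ zipWith ℤ._+_ (μπ π) (sub α (V π))) ⇔
  (map +_ (toList (μ +ρ)) ≡ sub (α +ρᶻ) (V π))
μ-translate {m} {n} π μ α =
  translate n 0 (V π) μ α (trans (cong (_+ m) (ℕP.+-identityʳ n)) (ℕP.+-comm n m))

ν-translate : ∀ {m n} (π : Path n m) (ν : Vec ℕ n) (α : Vec ℤ (m + n)) →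
  (map +_ (toList ν) ≡ zipWith ℤ._+_ (ν'π π) (sub α (H π))) ⇔
  (map +_ (toList (ν +ρ)) ≡ sub (α +ρᶻ) (H π))
ν-translate {m} {n} π ν α = translate m 0 (H π) ν α (cong (_+ n) (ℕP.+-identityʳ m))

-- Merging two strictly decreasing lists along a path

HeadAtMost : ℕ → List ℕ → Set
HeadAtMost b X = Connected _≥_ (just b) (List.head X)

-- A path s and a weakly decreasing γ whose south and west parts are X, Y.
-- The field `bounded` records that γ starts with the head of X or of Y.
record Interleaving (k : ℕ) (X Y : List ℕ) : Set where
  field
    steps   : Vec Step k
    merged  : Vec ℕ k
    south   : southPart steps merged ≡ X
    west    : westPart steps merged ≡ Y
    sorted  : Linked _≥_ (toList merged)
    bounded : ∀ {b} → HeadAtMost b X → HeadAtMost b Y → HeadAtMost b (toList merged)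

-- Prepend the head x of X (resp. y of Y) as a south (resp. west) step; it
-- dominates what follows because X (resp. Y) is strictly decreasing.
consSouth : ∀ {k x X Y} → Linked _>_ (x ∷ X) → HeadAtMost x Y → Interleaving k X Y →
  Interleaving (suc k) (x ∷ X) Y
consSouth {x = x} sx x≥Y I = record
  { steps = S ∷ steps ; merged = x ∷ merged ; south = cong (x ∷_) south ; west = west
  ; sorted = bounded (Linked.head′ (Linked.map ℕP.<⇒≤ sx)) x≥Y ∷′ sorted
  ; bounded = λ b≥x _ → b≥x }
  where open Interleaving I

consWest : ∀ {k y X Y} → Linked _>_ (y ∷ Y) → HeadAtMost y X → Interleaving k X Y →
  Interleaving (suc k) X (y ∷ Y)
consWest {y = y} sy y≥X I = record
  { steps = W ∷ steps ; merged = y ∷ merged ; south = south ; west = cong (y ∷_) west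
  ; sorted = bounded y≥X (Linked.head′ (Linked.map ℕP.<⇒≤ sy)) ∷′ sorted
  ; bounded = λ _ b≥y → b≥y }
  where open Interleaving I

merge : ∀ k (X Y : List ℕ) → length X + length Y ≡ k → Linked _>_ X → Linked _>_ Y → Interleaving k X Y
merge zero [] [] _ _ _ = record
  { steps = [] ; merged = [] ; south = refl ; west = refl ; sorted = [] ; bounded = λ _ _ → just-nothing }
merge (suc k) (x ∷ X) [] eq sx sy =
  consSouth sx just-nothing (merge k X [] (ℕP.suc-injective eq) (Linked.tail sx) sy)
merge (suc k) [] (y ∷ Y) eq sx sy =
  consWest sy just-nothing (merge k [] Y (ℕP.suc-injective eq) sx (Linked.tail sy))
merge (suc k) (x ∷ X) (y ∷ Y) eq sx sy with y ℕP.≤? x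
... | yes y≤x = consSouth sx (just y≤x) (merge k X (y ∷ Y) (ℕP.suc-injective eq) (Linked.tail sx) sy)
... | no y≰x = consWest sy (just (ℕP.<⇒≤ (ℕP.≰⇒> y≰x))) (merge k (x ∷ X) Y eq′ sx (Linked.tail sy))
  where
  eq′ : length (x ∷ X) + length Y ≡ k
  eq′ = ℕP.suc-injective (trans (sym (ℕP.+-suc (length (x ∷ X)) (length Y))) eq)

-- γ − ρ is a quasi-partition when γ is an interleaving

-- The last entry of γ − ρ is γ's last entry minus 0.
lastNonneg : ∀ {k} (γ : Vec ℕ k) → LastNonneg (toList (γ -ρ))
lastNonneg [] = tt
lastNonneg (x ∷ []) = +≤+ z≤n
lastNonneg (x ∷ y ∷ γ) = lastNonneg (y ∷ γ)

-- Equal neighbouring steps lie in one strictly decreasing part; unequal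
-- ones are only weakly ordered by γ.
stepBound : ∀ {k} t t′ (s : Vec Step k) {x y} {γ : Vec ℕ k} →
  StrictParts (t ∷ t′ ∷ s) (x ∷ y ∷ γ) → y ≤ x →
  StepBound t t′ (+ x ℤ.- + suc k) (+ y ℤ.- + k)
stepBound S S _ (south , _) _ = to (descent⇔ _) (Linked.head south)
stepBound W W _ (_ , west) _ = to (descent⇔ _) (Linked.head west)
stepBound S W _ _ y≤x = weakDescent _ y≤x
stepBound W S _ _ y≤x = weakDescent _ y≤x

adjBound : ∀ {k} (s : Vec Step k) (γ : Vec ℕ k) → StrictParts s γ → Linked _≥_ (toList γ) →
  AdjBound (zip (toList s) (toList (γ -ρ)))
adjBound [] [] _ _ = tt
adjBound (_ ∷ []) (_ ∷ []) _ _ = tt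
adjBound (t ∷ t′ ∷ s) (x ∷ y ∷ γ) sp (y≤x ∷ w) =
  stepBound t t′ s sp y≤x , adjBound (t′ ∷ s) (y ∷ γ) (strictParts-tail t (t′ ∷ s) sp) w

-- Two of three consecutive steps are equal, so one pair among three
-- consecutive entries of γ is adjacent in a part and strictly descends.
tripleDescent : ∀ {k} t₁ t₂ t₃ (s : Vec Step k) {x₁ x₂ x₃} {γ : Vec ℕ k} →
  StrictParts (t₁ ∷ t₂ ∷ t₃ ∷ s) (x₁ ∷ x₂ ∷ x₃ ∷ γ) →
  x₂ < x₁ ⊎ x₃ < x₂ ⊎ x₃ < x₁
tripleDescent S S _ _ (south , _) = inj₁ (Linked.head south)
tripleDescent W W _ _ (_ , west) = inj₁ (Linked.head west)
tripleDescent W S S _ (south , _) = inj₂ (inj₁ (Linked.head south))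
tripleDescent S W W _ (_ , west) = inj₂ (inj₁ (Linked.head west))
tripleDescent S W S _ (south , _) = inj₂ (inj₂ (Linked.head south))
tripleDescent W S W _ (_ , west) = inj₂ (inj₂ (Linked.head west))

-- A double strict ascent of γ − ρ would make γ weakly increase twice.
noDoubleAscent : ∀ {x₁ x₂ x₃} r → x₂ < x₁ ⊎ x₃ < x₂ ⊎ x₃ < x₁ →
  ¬ ((+ x₁ ℤ.- + suc (suc r)) ℤ.< (+ x₂ ℤ.- + suc r) × (+ x₂ ℤ.- + suc r) ℤ.< (+ x₃ ℤ.- + r))
noDoubleAscent {x₁} {x₂} {x₃} r descent (a₁₂ , a₂₃) = refute descent
  where
  x₁≤x₂ : x₁ ≤ x₂
  x₁≤x₂ = ascent⇒≤ {x₁} {x₂} (suc r) a₁₂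
  x₂≤x₃ : x₂ ≤ x₃
  x₂≤x₃ = ascent⇒≤ {x₂} {x₃} r a₂₃
  refute : x₂ < x₁ ⊎ x₃ < x₂ ⊎ x₃ < x₁ → ⊥
  refute (inj₁ x₂<x₁) = ℕP.<⇒≱ x₂<x₁ x₁≤x₂
  refute (inj₂ (inj₁ x₃<x₂)) = ℕP.<⇒≱ x₃<x₂ x₂≤x₃
  refute (inj₂ (inj₂ x₃<x₁)) = ℕP.<⇒≱ x₃<x₁ (ℕP.≤-trans x₁≤x₂ x₂≤x₃)

noStrictAscent : ∀ {k} (s : Vec Step k) (γ : Vec ℕ k) → StrictParts s γ → NoStrictAscent3 (toList (γ -ρ))
noStrictAscent [] [] _ = tt
noStrictAscent (_ ∷ []) (_ ∷ []) _ = tt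
noStrictAscent (_ ∷ _ ∷ []) (_ ∷ _ ∷ []) _ = tt
noStrictAscent (t₁ ∷ t₂ ∷ t₃ ∷ s) (x₁ ∷ x₂ ∷ x₃ ∷ γ) sp =
  noDoubleAscent _ (tripleDescent t₁ t₂ t₃ s sp) ,
  noStrictAscent (t₂ ∷ t₃ ∷ s) (x₂ ∷ x₃ ∷ γ) (strictParts-tail t₁ (t₂ ∷ t₃ ∷ s) sp)

interleaving⇒quasiPartition : ∀ {m n} (π : Path n m) (γ : Vec ℕ (m + n)) → StrictParts (proj₁ π) γ →
  Linked _≥_ (toList γ) → IsQuasiPartition π (γ -ρ)
interleaving⇒quasiPartition (s , _) γ sp w = lastNonneg γ , noStrictAscent s γ sp , adjBound s γ sp w

decreasing⇒strict : ∀ {k} (γ : Vec ℕ k) → Decreasingℤ (toList (γ -ρ)) → Linked _>_ (toList γ)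
decreasing⇒strict [] _ = []
decreasing⇒strict (x ∷ []) _ = [-]
decreasing⇒strict (x ∷ y ∷ γ) (le , d) = from (descent⇔ _) le ∷ decreasing⇒strict (y ∷ γ) d

-- A quasi-partition with disjoint parts of α + ρ is a partition

coincide : ∀ k {a b : ℤ} → b ≡ a ℤ.+ + 1 → a ℤ.+ + suc k ≡ b ℤ.+ + k
coincide k {a} e = trans (sym (ℤP.+-assoc a (+ 1) (+ k))) (cong (ℤ._+ + k) (sym e))

-- With unequal neighbouring steps, α_{i+1} = α_i + 1 would put the same
-- value of γ = α + ρ into both parts.
pairDecreasing : ∀ {k} t t′ (s : Vec Step k) {a b : ℤ} {α : Vec ℤ k} → StepBound t t′ a b →
  Disjoint (southPart (t ∷ t′ ∷ s) ((a ∷ b ∷ α) +ρᶻ)) (westPart (t ∷ t′ ∷ s) ((a ∷ b ∷ α) +ρᶻ)) →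
  b ℤ.≤ a
pairDecreasing S S _ b≤a _ = b≤a
pairDecreasing W W _ b≤a _ = b≤a
pairDecreasing {k} S W _ {a} b≤a+1 dj = ≤-below-suc b≤a+1 (λ e → dj (here refl , here (coincide k {a} e)))
pairDecreasing {k} W S _ {a} b≤a+1 dj = ≤-below-suc b≤a+1 (λ e → dj (here (coincide k {a} e) , here refl))

disjoint⇒decreasing : ∀ {k} (s : Vec Step k) (α : Vec ℤ k) → AdjBound (zip (toList s) (toList α)) →
  Disjoint (southPart s (α +ρᶻ)) (westPart s (α +ρᶻ)) → Decreasingℤ (toList α)
disjoint⇒decreasing [] [] _ _ = tt
disjoint⇒decreasing (_ ∷ []) (_ ∷ []) _ _ = tt
disjoint⇒decreasing (t ∷ t′ ∷ s) (a ∷ b ∷ α) (bound , adj) dj =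
  pairDecreasing t t′ s bound dj ,
  disjoint⇒decreasing (t′ ∷ s) (b ∷ α) adj (disjoint-tail t (t′ ∷ s) dj)

decreasing⇒partition : (xs : List ℤ) → Decreasingℤ xs → LastNonneg xs → IsPartitionℤ xs
decreasing⇒partition [] _ _ = [] , tt
decreasing⇒partition (x ∷ []) _ ln = ln ∷ [] , tt
decreasing⇒partition (x ∷ y ∷ r) (y≤x , d) ln with decreasing⇒partition (y ∷ r) d ln
... | 0≤y ∷ nonneg , _ = ℤP.≤-trans 0≤y y≤x ∷ 0≤y ∷ nonneg , y≤x , d

disjoint⇒partition : ∀ {m n} (π : Path n m) (α : Vec ℤ (m + n)) → IsQuasiPartition π α →
  Disjoint (southPart (proj₁ π) (α +ρᶻ)) (westPart (proj₁ π) (α +ρᶻ)) → IsPartitionℤ (toList α)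
disjoint⇒partition (s , _) α (ln , _ , adj) dj =
  decreasing⇒partition (toList α) (disjoint⇒decreasing s α adj dj) ln

QuasiWitness : ∀ {m n} → Vec ℕ m → Vec ℕ n → Set
QuasiWitness {m} {n} μ ν =
  Σ (Path n m) λ π → Σ (Vec ℤ (m + n)) λ α →
    IsQuasiPartition π α × ¬ IsPartitionℤ (toList α) ×
    map +_ (toList μ) ≡ zipWith ℤ._+_ (μπ π) (sub α (V π)) ×
    map +_ (toList ν) ≡ zipWith ℤ._+_ (ν'π π) (sub α (H π))

-- Merge μ + ρ and ν + ρ; the merged sequence cannot be strictly decreasing,
-- as then it would be κ + ρ for a partition κ.
starInfinite⇒witness : ∀ {m n} (μ : Vec ℕ m) (ν : Vec ℕ n) → IsPartition μ → IsPartition ν →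
  StarInfinite μ ν → QuasiWitness μ ν
starInfinite⇒witness {m} {n} μ ν pμ pν noκ =
  π , merged -ρ , interleaving⇒quasiPartition π merged parts sorted ,
  (λ (_ , dec) → notStrict (decreasing⇒strict merged dec)) ,
  from (μ-translate π μ (merged -ρ)) (liftedPart merged (V π) (trans (posS-southPart steps merged) south)) ,
  from (ν-translate π ν (merged -ρ)) (liftedPart merged (H π) (trans (posW-westPart steps merged) west))
  where
  sμ : Linked _>_ (toList (μ +ρ))
  sμ = partition⇒strict μ pμ
  sν : Linked _>_ (toList (ν +ρ))
  sν = partition⇒strict ν pν
  open Interleaving (merge (m + n) (toList (μ +ρ)) (toList (ν +ρ))
    (cong₂ _+_ (VP.length-toList (μ +ρ)) (VP.length-toList (ν +ρ))) sμ sν)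
  π : Path n m
  π = steps , trans (sym (length-southPart steps merged)) (trans (cong length south) (VP.length-toList (μ +ρ)))
  parts : StrictParts steps merged
  parts = subst (Linked _>_) (sym south) sμ , subst (Linked _>_) (sym west) sν
  notStrict : ¬ Linked _>_ (toList merged)
  notStrict sd = noκ (merged ∸ρ , ∸ρ-partition merged sd ,
    subst (λ v → toList v ↭ _) (sym (∸ρ+ρ merged sd))
      (subst₂ (λ X Y → toList merged ↭ X ++ Y) south west (split-↭ steps merged)))

-- A partition κ as in the definition of ⋆ separates the values of μ + ρ and
-- ν + ρ, which are the two parts of α + ρ.
witness⇒starInfinite : ∀ {m n} (μ : Vec ℕ m) (ν : Vec ℕ n) → QuasiWitness μ ν → StarInfinite μ ν
witness⇒starInfinite μ ν (π@(s , _) , α , quasi , notPartition , μ-eq , ν-eq) (κ , pκ , κ↭AB) =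
  notPartition (disjoint⇒partition π α quasi (subst₂ Disjoint southEq westEq separated))
  where
  separated : Disjoint (map +_ (toList (μ +ρ))) (map +_ (toList (ν +ρ)))
  separated = rearrangement⇒disjoint κ _ _ pκ κ↭AB
  southEq : map +_ (toList (μ +ρ)) ≡ southPart s (α +ρᶻ)
  southEq = trans (to (μ-translate π μ α) μ-eq) (posS-southPart s (α +ρᶻ))
  westEq : map +_ (toList (ν +ρ)) ≡ westPart s (α +ρᶻ)
  westEq = trans (to (ν-translate π ν α) ν-eq) (posW-westPart s (α +ρᶻ))

mainTheorem4 : (m n : ℕ) (μ : Vec ℕ m) (ν : Vec ℕ n) →
    IsPartition μ → IsPartition ν →
    StarInfinite μ ν ⇔
      (Σ (Path n m) λ π → Σ (Vec ℤ (m + n)) λ α →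
         IsQuasiPartition π α ×
         ¬ IsPartitionℤ (toList α) ×
         map +_ (toList μ) ≡ zipWith Data.Integer._+_ (μπ π) (sub α (V π)) ×
         map +_ (toList ν) ≡ zipWith Data.Integer._+_ (ν'π π) (sub α (H π)))
mainTheorem4 m n μ ν pμ pν =
  mk⇔ (starInfinite⇒witness μ ν pμ pν) (witness⇒starInfinite μ ν)
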